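{- Let $\mathbf{M}$ be an $m\times n$ interval matrix with the weak Monge property and let $\mathbf{M}^R$ be its interval residual matrix. Then there exists a real matrix $M^R\in\mathbf{M}^R$ that is entrywise nonnegative.
   Context: An interval matrix $\mathbf{M}=[\underline{M},\overline{M}]$ with real $m\times n$ matrices $\underline{M}\le\overline{M}$ is the set $\{A\in\mathbb{R}^{m\times n}:\underline{M}\le A\le\overline{M}\}$ (entrywise), with entries $[\underline{m}_{ij},\overline{m}_{ij}]$. A real matrix $A$ is Monge if $a_{ij}+a_{k\ell}\le a_{i\ell}+a_{kj}$ for all $i<k$, $j<\ell$. $\mathbf{M}$ has the weak Monge property if it contains a Monge matrix. The interval residual matrix $\mathbf{M}^R$ is the $(m-1)\times(n-1)$ interval matrix with entries $\mathbf{m}^R_{ij}=[\underline{m}_{i+1,j}+\underline{m}_{i,j+1}-\overline{m}_{ij}-\overline{m}_{i+1,j+1},\ \overline{m}_{i+1,j}+\overline{m}_{i,j+1}-\underline{m}_{ij}-\underline{m}_{i+1,j+1}]$. -}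

module Defs where

open import Level using (Level; _⊔_; suc)
open import Data.Nat using (ℕ) renaming (suc to 1+)
open import Data.Fin using (Fin; inject₁; _<_) renaming (suc to fsuc)
open import Data.Product using (Σ; _×_; _,_)
open import Algebra.Bundles using (CommutativeRing)
open import Relation.Binary.Structures using (IsTotalOrder)

-- A (totally) ordered commutative ring.  The real numbers ℝ are an instance;
-- agda-stdlib has no reals, so the statement is made for every such ring.
record OrderedCommutativeRing (c ℓ₁ ℓ₂ : Level) : Set (suc (c ⊔ ℓ₁ ⊔ ℓ₂)) where
  field
    commRing : CommutativeRing c ℓ₁
  open CommutativeRing commRing public
  field
    _≤_          : Carrier → Carrier → Set ℓ₂
    isTotalOrder : IsTotalOrder _≈_ _≤_
    +-mono-≤     : ∀ {x y} z → x ≤ y → (x + z) ≤ (y + z)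
    *-nonneg     : ∀ {x y} → 0# ≤ x → 0# ≤ y → 0# ≤ (x * y)

module _ {c ℓ₁ ℓ₂} (R : OrderedCommutativeRing c ℓ₁ ℓ₂) where
  open OrderedCommutativeRing R

  Matrix : ℕ → ℕ → Set c
  Matrix m n = Fin m → Fin n → Carrier

  record IntervalMatrix (m n : ℕ) : Set (c ⊔ ℓ₂) where
    field
      lo   : Matrix m n
      hi   : Matrix m n
      lo≤hi : ∀ i j → lo i j ≤ hi i j

  _∈ᴵ_ : ∀ {m n} → Matrix m n → IntervalMatrix m n → Set ℓ₂
  A ∈ᴵ M = ∀ i j → (IntervalMatrix.lo M i j ≤ A i j) × (A i j ≤ IntervalMatrix.hi M i j)

  IsMonge : ∀ {m n} → Matrix m n → Set ℓ₂
  IsMonge A = ∀ {i k j l} → i < k → j < l →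
              (A i j + A k l) ≤ (A i l + A k j)

  WeakMonge : ∀ {m n} → IntervalMatrix m n → Set (c ⊔ ℓ₂)
  WeakMonge {m} {n} M = Σ (Matrix m n) λ A → (A ∈ᴵ M) × IsMonge A

  -- interval residual matrix of an (m+1) × (n+1) interval matrix; it is m × n.
  -- index i ↦ inject₁ i is "i", fsuc i is "i+1".
  residualLo residualHi : ∀ {m n} → IntervalMatrix (1+ m) (1+ n) → Matrix m n
  residualLo M i j = (lo (fsuc i) (inject₁ j) + lo (inject₁ i) (fsuc j))
                     - (hi (inject₁ i) (inject₁ j) + hi (fsuc i) (fsuc j))
    where open IntervalMatrix M
  residualHi M i j = (hi (fsuc i) (inject₁ j) + hi (inject₁ i) (fsuc j))
                     - (lo (inject₁ i) (inject₁ j) + lo (fsuc i) (fsuc j))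
    where open IntervalMatrix M

  _∈ᴿ_ : ∀ {m n} → Matrix m n → IntervalMatrix (1+ m) (1+ n) → Set ℓ₂
  A ∈ᴿ M = ∀ i j → (residualLo M i j ≤ A i j) × (A i j ≤ residualHi M i j)

  Nonneg : ∀ {m n} → Matrix m n → Set ℓ₂
  Nonneg A = ∀ i j → 0# ≤ A i j

-- The residual of a single matrix A, with entries a(i+1,j) + a(i,j+1) − a(i,j) − a(i+1,j+1),
-- is monotone in the entries placed with a plus sign and antitone in the others, so
-- A ∈ M forces residual A ∈ M^R.  If A is Monge, the Monge inequality for the adjacent
-- rows i < i+1 and columns j < j+1 makes every entry of residual A nonnegative.
module Submission where

open import Data.Nat using (ℕ; suc)
open import Data.Fin using (Fin; inject₁) renaming (suc to fsuc; _<_ to _<ᶠ_)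
open import Data.Fin.Properties using (≤̄⇒inject₁<) renaming (≤-refl to ≤ᶠ-refl)
open import Data.Product using (Σ; _×_; _,_; proj₁; proj₂)
open import Relation.Binary.Structures using (IsTotalOrder)
open import Defs

inject₁<suc : ∀ {n} (i : Fin n) → inject₁ i <ᶠ fsuc i
inject₁<suc i = ≤̄⇒inject₁< ≤ᶠ-refl

module OrderedCommutativeRingProperties {c ℓ₁ ℓ₂} (R : OrderedCommutativeRing c ℓ₁ ℓ₂) where
  open OrderedCommutativeRing R
  open IsTotalOrder isTotalOrder using (≤-resp-≈) renaming (trans to ≤-trans)
  open import Algebra.Properties.AbelianGroup +-abelianGroup using (xyx⁻¹≈y)
  open import Relation.Binary.Reasoning.Setoid setoid

  ≤-respˡ-≈ : ∀ {x y z} → x ≈ y → x ≤ z → y ≤ z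
  ≤-respˡ-≈ = proj₂ ≤-resp-≈

  ≤-respʳ-≈ : ∀ {x y z} → y ≈ z → x ≤ y → x ≤ z
  ≤-respʳ-≈ = proj₁ ≤-resp-≈

  +-mono-≤₂ : ∀ {a b c d} → a ≤ b → c ≤ d → (a + c) ≤ (b + d)
  +-mono-≤₂ {a} {b} {c} {d} a≤b c≤d = ≤-trans (+-mono-≤ c a≤b)
    (≤-respˡ-≈ (+-comm c b) (≤-respʳ-≈ (+-comm d b) (+-mono-≤ b c≤d)))

  -‿antimono-≤ : ∀ {a b} → a ≤ b → (- b) ≤ (- a)
  -‿antimono-≤ {a} {b} a≤b =
    ≤-respˡ-≈ a-cancels (≤-respʳ-≈ b-cancels (+-mono-≤ (- b + - a) a≤b))
    where
    a-cancels : a + (- b + - a) ≈ - b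
    a-cancels = trans (sym (+-assoc a (- b) (- a))) (xyx⁻¹≈y a (- b))
    b-cancels : b + (- b + - a) ≈ - a
    b-cancels = begin
      b + (- b + - a) ≈⟨ sym (+-assoc b (- b) (- a)) ⟩
      (b + - b) + - a ≈⟨ +-congʳ (-‿inverseʳ b) ⟩
      0# + - a        ≈⟨ +-identityˡ (- a) ⟩
      - a             ∎

  -‿mono-≤₂ : ∀ {a b c d} → a ≤ b → d ≤ c → (a - c) ≤ (b - d)
  -‿mono-≤₂ a≤b d≤c = +-mono-≤₂ a≤b (-‿antimono-≤ d≤c)

  x≤y⇒0≤y-x : ∀ {x y} → x ≤ y → 0# ≤ (y - x)
  x≤y⇒0≤y-x {x} x≤y = ≤-respˡ-≈ (-‿inverseʳ x) (+-mono-≤ (- x) x≤y)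

module Residual {c ℓ₁ ℓ₂} (R : OrderedCommutativeRing c ℓ₁ ℓ₂) where
  open OrderedCommutativeRing R
  open OrderedCommutativeRingProperties R

  residual : ∀ {m n} → Matrix R (suc m) (suc n) → Matrix R m n
  residual A i j = (A (fsuc i) (inject₁ j) + A (inject₁ i) (fsuc j))
                   - (A (inject₁ i) (inject₁ j) + A (fsuc i) (fsuc j))

  residual-∈ᴿ : ∀ {m n} {A : Matrix R (suc m) (suc n)} {M : IntervalMatrix R (suc m) (suc n)} →
                _∈ᴵ_ R A M → _∈ᴿ_ R (residual A) M
  residual-∈ᴿ {A = A} {M} A∈M i j =
    -‿mono-≤₂ (+-mono-≤₂ (lo≤A _ _) (lo≤A _ _)) (+-mono-≤₂ (A≤hi _ _) (A≤hi _ _)) ,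
    -‿mono-≤₂ (+-mono-≤₂ (A≤hi _ _) (A≤hi _ _)) (+-mono-≤₂ (lo≤A _ _) (lo≤A _ _))
    where
    open IntervalMatrix M
    lo≤A : ∀ i j → lo i j ≤ A i j
    lo≤A i j = proj₁ (A∈M i j)
    A≤hi : ∀ i j → A i j ≤ hi i j
    A≤hi i j = proj₂ (A∈M i j)

  Monge⇒residual-nonneg : ∀ {m n} {A : Matrix R (suc m) (suc n)} →
                          IsMonge R A → Nonneg R (residual A)
  Monge⇒residual-nonneg monge i j =
    x≤y⇒0≤y-x (≤-respʳ-≈ (+-comm _ _) (monge (inject₁<suc i) (inject₁<suc j)))

proposition4p1 : ∀ {c ℓ₁ ℓ₂} (R : OrderedCommutativeRing c ℓ₁ ℓ₂) (m n : ℕ)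
                 (M : IntervalMatrix R (suc m) (suc n)) →
                 WeakMonge R M →
                 Σ (Matrix R m n) λ MR → (_∈ᴿ_ R MR M) × Nonneg R MR
proposition4p1 R m n M (A , A∈M , monge) =
  residual A , residual-∈ᴿ {A = A} {M} A∈M , Monge⇒residual-nonneg {A = A} monge
  where open Residual R
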